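{- Let $Q$ be a $\sigma$-bqo poset and for each $q\in Q$ let $P_q$ be a $\sigma$-bqo poset. Then the lexicographic sum $\Sigma_{q\in Q}P_q$ is $\sigma$-bqo.
   Context: The lexicographic sum $\Sigma_{q\in Q}P_q$ is the set $\{(q,p): q\in Q, p\in P_q\}$ ordered by $(q,p)\le(q',p')$ iff $q<_Q q'$, or $q=q'$ and $p\le_{P_q}p'$. A poset is wqo if it has no infinite antichain and no infinite strictly decreasing sequence. A barrier is an infinite set $B\subseteq[\omega]^{<\omega}$ which is an antichain under $\subseteq$ and such that every infinite subset of $\bigcup B$ has an initial segment (set of its $k$ smallest elements, some $k$) in $B$. For nonempty finite $r,s\subseteq\omega$, $r\triangleleft s$ means $\min r<\min s$ and $r\setminus\{\min r\}$ is a proper initial segment of $s$. A map $f:B\to P$ from a barrier is good if there are $s\triangleleft t$ in $B$ with $f(s)\le_P f(t)$; $P$ is bqo if every map from a barrier into $P$ is good. A poset is $\sigma$-bqo if it is wqo and is a union of countably many subsets each of which is bqo with the induced order. -}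

module Defs where

open import Data.Nat using (ℕ; zero; suc; _<_)
open import Data.List using (List; []; _∷_; take; length; _++_)
open import Data.List.Membership.Propositional using (_∈_)
open import Data.List.Relation.Unary.Linked using (Linked)
open import Data.Product using (Σ; ∃; _×_; _,_; proj₁)
open import Data.Sum using (_⊎_)
open import Relation.Nullary using (¬_)
open import Relation.Binary.PropositionalEquality using (_≡_; subst)
open import Relation.Binary.Structures using (IsPartialOrder)

IsPoset : (A : Set) → (A → A → Set) → Set
IsPoset A _≤_ = IsPartialOrder _≡_ _≤_

Strict : {A : Set} → (A → A → Set) → A → A → Set
Strict _≤_ x y = x ≤ y × ¬ (x ≡ y)

HasInfiniteAntichain : (A : Set) → (A → A → Set) → Set
HasInfiniteAntichain A _≤_ =
  Σ (ℕ → A) λ f → ∀ i j → ¬ (i ≡ j) → ¬ (f i ≤ f j)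

HasInfiniteDescending : (A : Set) → (A → A → Set) → Set
HasInfiniteDescending A _≤_ =
  Σ (ℕ → A) λ f → ∀ i → Strict _≤_ (f (suc i)) (f i)

IsWqo : (A : Set) → (A → A → Set) → Set
IsWqo A _≤_ = ¬ HasInfiniteAntichain A _≤_ × ¬ HasInfiniteDescending A _≤_

-- Finite subsets of ω are represented canonically as strictly
-- increasing lists of naturals.

Sorted : List ℕ → Set
Sorted = Linked _<_

-- the set of the k smallest elements of an infinite set, given as a
-- strictly increasing enumeration f
initSeg : (ℕ → ℕ) → ℕ → List ℕ
initSeg f zero = []
initSeg f (suc k) = initSeg f k ++ (f k ∷ [])

StrictlyIncreasing : (ℕ → ℕ) → Set
StrictlyIncreasing f = ∀ i → f i < f (suc i)

_⊆ₗ_ : List ℕ → List ℕ → Set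
s ⊆ₗ t = ∀ x → x ∈ s → x ∈ t

FiniteFamily : (List ℕ → Set) → Set
FiniteFamily B = Σ (List (List ℕ)) λ L → ∀ s → B s → s ∈ L

record IsBarrier (B : List ℕ → Set) : Set where
  field
    members-sorted : ∀ s → B s → Sorted s
    infinite       : ¬ FiniteFamily B
    antichain      : ∀ s t → B s → B t → s ⊆ₗ t → s ≡ t
    -- every infinite subset X of ⋃B (enumerated increasingly by f)
    -- has an initial segment in B
    covering       : ∀ (f : ℕ → ℕ) → StrictlyIncreasing f →
                     (∀ i → Σ (List ℕ) λ s → B s × f i ∈ s) →
                     Σ ℕ λ k → B (initSeg f k)

-- r ◁ s : min r < min s and r ∖ {min r} is a proper initial segment of s
-- (for sorted lists, initial segments are prefixes `take k s`)
data _◁_ : List ℕ → List ℕ → Set where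
  ◁-intro : ∀ {a b r' s'} (k : ℕ) → a < b →
            k < length (b ∷ s') → r' ≡ take k (b ∷ s') →
            (a ∷ r') ◁ (b ∷ s')

Good : {P : Set} (_≤_ : P → P → Set) (B : List ℕ → Set) →
       ((s : List ℕ) → B s → P) → Set
Good _≤_ B f = Σ (List ℕ) λ s → Σ (List ℕ) λ t → Σ (B s) λ bs → Σ (B t) λ bt →
               s ◁ t × f s bs ≤ f t bt

IsBqo : (P : Set) → (P → P → Set) → Set₁
IsBqo P _≤_ = (B : List ℕ → Set) → IsBarrier B →
              (f : (s : List ℕ) → B s → P) → Good _≤_ B f

Induced : {A : Set} (_≤_ : A → A → Set) (S : A → Set) → Σ A S → Σ A S → Set
Induced _≤_ S x y = proj₁ x ≤ proj₁ y

IsSigmaBqo : (A : Set) → (A → A → Set) → Set₁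
IsSigmaBqo A _≤_ =
  IsWqo A _≤_ ×
  Σ (ℕ → A → Set) λ S → (∀ a → Σ ℕ λ n → S n a) ×
                        (∀ n → IsBqo (Σ A (S n)) (Induced _≤_ (S n)))

LexSum : (Q : Set) (P : Q → Set) → Set
LexSum Q P = Σ Q P

LexLe : {Q : Set} (_≤Q_ : Q → Q → Set) (P : Q → Set)
        (_≤P_ : (q : Q) → P q → P q → Set) → LexSum Q P → LexSum Q P → Set
LexLe _≤Q_ P _≤P_ (q , p) (q' , p') =
  Strict _≤Q_ q q' ⊎ (Σ (q ≡ q') λ e → _≤P_ q' (subst P e p) p')

-- A bqo with an element decides every proposition: the singletons {n} form a barrier as
-- soon as ¬ ¬ ψ, and a good pair for a map out of it contains a proof of ψ. So the argument
-- may be classical, and it is the usual one.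
--
-- By Ramsey's theorem an antichain has a subsequence whose
-- first coordinates are either constant, giving an antichain in one fibre, or pairwise
-- distinct, giving one in Q. A descending sequence either drops in Q infinitely often or
-- eventually stays in one fibre. (The partial-order axioms are needed for Q only.)
--
-- For the σ-decomposition take the pieces {(q , p) : q ∈ Qₙ , p ∈ P_q,m}, indexed by pairs
-- (n , m). Given f from a barrier B into such a piece, colour each union s ∪ t with s ◁ t
-- in B by whether f s and f t have the same first coordinate; by the Nash-Williams theorem
-- some restriction B|N is monochromatic. If the colour is "different", goodness of the
-- first coordinates in the bqo Qₙ yields s ◁ t with a strict increase in Q. If it is
-- "same", ◁-chains connect any two members of B|N, so f lands in a single bqo fibre P_q,m.

module Submission where

open import Axiom.DoubleNegationElimination using (DoubleNegationElimination; dne⇒em; em⇒dne)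
open import Axiom.ExcludedMiddle using (ExcludedMiddle)
open import Data.Bool as Bool using (Bool; T)
open import Data.Empty using (⊥-elim)
open import Data.List using (List; []; _∷_; _++_; _∷ʳ_; [_]; take; length; map)
open import Data.List.Membership.Propositional using (_∈_)
open import Data.List.Membership.Propositional.Properties using (∈-++⁺ˡ; ∈-++⁺ʳ; ∈-++⁻; ∈-map⁺)
open import Data.List.Properties using (++-assoc; ++-identityʳ; take-all)
open import Data.List.Relation.Unary.Any using (here; there)
open import Data.List.Relation.Unary.Linked as Linked using ([]; [-]; _∷_)
open import Data.List.Reverse using (Reverse; reverseView; []; _∶_∶ʳ_)
open import Data.Nat using (ℕ; zero; suc; _+_; _≤_; _<_; z≤n; s≤s; _≟_; _≤?_; _<?_)
open import Data.Nat.Induction using (<-wellFounded)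
open import Data.Nat.InfinitelyOften using () renaming (Fin to FinitelyOften; Inf to InfinitelyOften)
open import Data.Nat.ListAction using (sum)
open import Data.Nat.Properties
open import Data.Product using (Σ; ∃; ∃₂; _×_; _,_; proj₁; proj₂; uncurry)
open import Data.Sum using (_⊎_; inj₁; inj₂; [_,_]′)
open import Function using (_∘_)
open import Induction.WellFounded using (Acc; acc)
open import Level using (0ℓ)
open import Relation.Binary.Definitions using (tri<; tri≈; tri>)
open import Relation.Binary.PropositionalEquality using (_≡_; refl; sym; trans; cong; subst)
open import Relation.Binary.Structures using (IsPartialOrder)
open import Relation.Nullary using (¬_; yes; no)
open import Relation.Nullary.Decidable using (⌊_⌋; toWitness; fromWitness)

open import Defs

head<tail : ∀ {x s y} → Sorted (x ∷ s) → y ∈ s → x < y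
head<tail (x<z ∷ _)  (here refl)  = x<z
head<tail (x<z ∷ zs) (there y∈s) = <-trans x<z (head<tail zs y∈s)

sorted-∷ : ∀ {x s} → (∀ {y} → y ∈ s → x < y) → Sorted s → Sorted (x ∷ s)
sorted-∷ {s = []}    _   _  = [-]
sorted-∷ {s = _ ∷ _} x<s zs = x<s (here refl) ∷ zs

sorted-∷ʳ : ∀ {s z} → (∀ {y} → y ∈ s → y < z) → Sorted s → Sorted (s ∷ʳ z)
sorted-∷ʳ {[]}    _   _  = [-]
sorted-∷ʳ {x ∷ s} {z} s<z xs = sorted-∷ x<s∷ʳz (sorted-∷ʳ (λ y∈s → s<z (there y∈s)) (Linked.tail xs))
  where
  x<s∷ʳz : ∀ {y} → y ∈ s ∷ʳ z → x < y
  x<s∷ʳz y∈ with ∈-++⁻ s y∈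
  ... | inj₁ y∈s         = head<tail xs y∈s
  ... | inj₂ (here refl) = s<z (here refl)

sorted-∷ʳ⁻ : ∀ s {z} → Sorted (s ∷ʳ z) → Sorted s × (∀ {y} → y ∈ s → y < z)
sorted-∷ʳ⁻ []      _  = [] , λ ()
sorted-∷ʳ⁻ (x ∷ s) xs with sorted-∷ʳ⁻ s (Linked.tail xs)
... | ss , s<z = sorted-∷ (λ y∈s → head<tail xs (∈-++⁺ˡ y∈s)) ss ,
                 λ { (here refl) → head<tail xs (∈-++⁺ʳ s (here refl)) ; (there y∈s) → s<z y∈s }

∈⇒≤sum : ∀ {x s} → x ∈ s → x ≤ sum s
∈⇒≤sum {s = y ∷ s} (here refl)  = m≤m+n y (sum s)
∈⇒≤sum {s = y ∷ s} (there x∈s) = ≤-trans (∈⇒≤sum x∈s) (m≤n+m (sum s) y)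

∈∈⇒≤sum : ∀ {x s L} → x ∈ s → s ∈ L → x ≤ sum (map sum L)
∈∈⇒≤sum x∈s s∈L = ≤-trans (∈⇒≤sum x∈s) (∈⇒≤sum (∈-map⁺ sum s∈L))

<+suc⇒<suc+ : ∀ {y} a {n} → y < a + suc n → y < suc a + n
<+suc⇒<suc+ {y} a {n} = subst (y <_) (+-suc a n)

sortedWithin : ℕ → ℕ → List (List ℕ)
sortedWithin a zero    = [ [] ]
sortedWithin a (suc n) = sortedWithin (suc a) n ++ map (a ∷_) (sortedWithin (suc a) n)

sortedWithin-complete : ∀ n a {s} → Sorted s → (∀ {x} → x ∈ s → a ≤ x × x < a + n) →
                        s ∈ sortedWithin a n
sortedWithin-complete zero a {[]} _ _ = here refl
sortedWithin-complete zero a {x ∷ s} _ bounds with bounds (here refl)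
... | a≤x , x<a+0 = ⊥-elim (<⇒≱ (subst (x <_) (+-identityʳ a) x<a+0) a≤x)
sortedWithin-complete (suc n) a {[]} _ _ = ∈-++⁺ˡ (sortedWithin-complete n (suc a) [] λ ())
sortedWithin-complete (suc n) a {x ∷ s} xs bounds with x ≟ a
... | yes refl = ∈-++⁺ʳ (sortedWithin (suc a) n) (∈-map⁺ (a ∷_)
                   (sortedWithin-complete n (suc a) (Linked.tail xs)
                     λ y∈s → head<tail xs y∈s , <+suc⇒<suc+ a (proj₂ (bounds (there y∈s)))))
... | no x≢a = ∈-++⁺ˡ (sortedWithin-complete n (suc a) xs
                 λ y∈ → a<y y∈ , <+suc⇒<suc+ a (proj₂ (bounds y∈)))
  where
  a<y : ∀ {y} → y ∈ x ∷ s → a < y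
  a<y (here refl)  = ≤∧≢⇒< (proj₁ (bounds (here refl))) (λ a≡x → x≢a (sym a≡x))
  a<y (there y∈s) = <-trans (a<y (here refl)) (head<tail xs y∈s)

sortedBelow : ℕ → List (List ℕ)
sortedBelow = sortedWithin 0

sortedBelow-complete : ∀ n {s} → Sorted s → (∀ {x} → x ∈ s → x < n) → s ∈ sortedBelow n
sortedBelow-complete n xs s<n = sortedWithin-complete n 0 xs λ x∈s → z≤n , s<n x∈s

∈-take⁻ : ∀ k {v : List ℕ} {x} → x ∈ take k v → x ∈ v
∈-take⁻ (suc k) {_ ∷ v} (here refl)  = here refl
∈-take⁻ (suc k) {_ ∷ v} (there x∈) = there (∈-take⁻ k x∈)

sorted-take : ∀ k {v} → Sorted v → Sorted (take k v)
sorted-take zero    _ = []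
sorted-take (suc k) {[]}    _  = []
sorted-take (suc k) {_ ∷ v} xs =
  sorted-∷ (λ y∈ → head<tail xs (∈-take⁻ k y∈)) (sorted-take k (Linked.tail xs))

∈-initSeg⁻ : ∀ f k {x} → x ∈ initSeg f k → ∃ λ i → i < k × x ≡ f i
∈-initSeg⁻ f (suc k) x∈ with ∈-++⁻ (initSeg f k) x∈
... | inj₁ x∈′ with ∈-initSeg⁻ f k x∈′
...   | i , i<k , refl = i , m<n⇒m<1+n i<k , refl
∈-initSeg⁻ f (suc k) x∈ | inj₂ (here refl) = k , ≤-refl , refl

∈-initSeg⁺ : ∀ f {i k} → i < k → f i ∈ initSeg f k
∈-initSeg⁺ f {i} {suc k} i<1+k with m≤n⇒m<n∨m≡n (≤-pred i<1+k)
... | inj₁ i<k  = ∈-++⁺ˡ (∈-initSeg⁺ f i<k)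
... | inj₂ refl = ∈-++⁺ʳ (initSeg f i) (here refl)

◁-sorted : ∀ {a r t} → (a ∷ r) ◁ t → Sorted t → Sorted (a ∷ t)
◁-sorted (◁-intro _ a<b _ _) ts =
  sorted-∷ (λ { (here refl) → a<b ; (there y∈) → <-trans a<b (head<tail ts y∈) }) ts

module _ {f : ℕ → ℕ} (f↑ : StrictlyIncreasing f) where

  increasing-< : ∀ {i j} → i < j → f i < f j
  increasing-< {i} {suc j} i<1+j with m≤n⇒m<n∨m≡n (≤-pred i<1+j)
  ... | inj₁ i<j  = <-trans (increasing-< i<j) (f↑ j)
  ... | inj₂ refl = f↑ i

  increasing-≤ : ∀ {i j} → i ≤ j → f i ≤ f j
  increasing-≤ i≤j with m≤n⇒m<n∨m≡n i≤j
  ... | inj₁ i<j  = <⇒≤ (increasing-< i<j)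
  ... | inj₂ refl = ≤-refl

  increasing-injective : ∀ {i j} → ¬ i ≡ j → ¬ f i ≡ f j
  increasing-injective {i} {j} i≢j fi≡fj with <-cmp i j
  ... | tri< i<j _ _ = <⇒≢ (increasing-< i<j) fi≡fj
  ... | tri≈ _ i≡j _ = i≢j i≡j
  ... | tri> _ _ j<i = <⇒≢ (increasing-< j<i) (sym fi≡fj)

  increasing-≥ : ∀ i → i ≤ f i
  increasing-≥ zero    = z≤n
  increasing-≥ (suc i) = ≤-<-trans (increasing-≥ i) (f↑ i)

  sorted-initSeg : ∀ k → Sorted (initSeg f k)
  sorted-initSeg zero    = []
  sorted-initSeg (suc k) = sorted-∷ʳ below (sorted-initSeg k)
    where
    below : ∀ {y} → y ∈ initSeg f k → y < f k
    below y∈ with ∈-initSeg⁻ f k y∈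
    ... | i , i<k , refl = increasing-< i<k

-- Bqos and excluded middle

SingletonsIf : Set → List ℕ → Set
SingletonsIf ψ s = (∃ λ n → s ≡ [ n ]) × ψ

singletonsIf-barrier : ∀ {ψ} → ¬ ¬ ψ → IsBarrier (SingletonsIf ψ)
singletonsIf-barrier {ψ} ¬¬ψ = record
  { members-sorted = λ { _ ((_ , refl) , _) → [-] }
  ; infinite       = λ { (L , complete) → ¬¬ψ λ ψ → fresh∉ L λ n → complete [ n ] ((n , refl) , ψ) }
  ; antichain      = λ { _ _ ((_ , refl) , _) ((_ , refl) , _) ⊆ → singleton-⊆ (⊆ _ (here refl)) }
  ; covering       = λ f _ covered → 1 , (f 0 , refl) , proj₂ (proj₁ (proj₂ (covered 0)))
  }
  where
  fresh∉ : ∀ L → ¬ (∀ n → [ n ] ∈ L)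
  fresh∉ L all∈ = <-irrefl refl (∈∈⇒≤sum (here refl) (all∈ (suc (sum (map sum L)))))
  singleton-⊆ : ∀ {n m} → n ∈ [ m ] → [ n ] ≡ [ m ]
  singleton-⊆ (here refl) = refl

bqo⇒dne : ∀ {A} (_≤_ : A → A → Set) → IsBqo A _≤_ → A → DoubleNegationElimination 0ℓ
bqo⇒dne _ bqo a ¬¬ψ with bqo _ (singletonsIf-barrier ¬¬ψ) (λ _ _ → a)
... | _ , _ , (_ , ψ) , _ = ψ

bqo⇒em : ∀ {A} (_≤_ : A → A → Set) → IsBqo A _≤_ → A → ExcludedMiddle 0ℓ
bqo⇒em _≤_ bqo a = dne⇒em (bqo⇒dne _≤_ bqo a)

bqo⇒barrierMember : ∀ {A B} (_≤_ : A → A → Set) → IsBqo A _≤_ → IsBarrier B →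
                    ((s : List ℕ) → B s → A) → ∃ B
bqo⇒barrierMember _ bqo bar f with bqo _ bar f
... | s , _ , s∈B , _ = s , s∈B

module SigmaBqo {A : Set} (_≤_ : A → A → Set) (σbqo : IsSigmaBqo A _≤_) where

  wqo : IsWqo A _≤_
  wqo = proj₁ σbqo

  Piece : ℕ → A → Set
  Piece = proj₁ (proj₂ σbqo)

  covered : ∀ a → ∃ λ n → Piece n a
  covered = proj₁ (proj₂ (proj₂ σbqo))

  piece-bqo : ∀ n → IsBqo (Σ A (Piece n)) (Induced _≤_ (Piece n))
  piece-bqo = proj₂ (proj₂ (proj₂ σbqo))

  σbqo⇒em : A → ExcludedMiddle 0ℓ
  σbqo⇒em a with covered a
  ... | n , a∈Aₙ = bqo⇒em (Induced _≤_ (Piece n)) (piece-bqo n) (a , a∈Aₙ)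

nextPair : ℕ × ℕ → ℕ × ℕ
nextPair (zero  , b) = suc b , zero
nextPair (suc a , b) = a , suc b

unpair : ℕ → ℕ × ℕ
unpair zero    = zero , zero
unpair (suc k) = nextPair (unpair k)

unpair-surjective : ∀ a b → ∃ λ k → unpair k ≡ (a , b)
unpair-surjective a b = onDiagonal (a + b) a b refl
  where
  onDiagonal : ∀ n a b → a + b ≡ n → ∃ λ k → unpair k ≡ (a , b)
  onDiagonal n       a       (suc b) a+b≡n with onDiagonal n (suc a) b (trans (sym (+-suc a b)) a+b≡n)
  ... | k , unpair-k = suc k , cong nextPair unpair-k
  onDiagonal n       zero    zero    _     = zero , refl
  onDiagonal zero    (suc a) zero    ()
  onDiagonal (suc n) (suc a) zero    a+0≡n
    with onDiagonal n zero a (suc-injective (trans (sym (+-identityʳ (suc a))) a+0≡n))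
  ... | k , unpair-k = suc k , cong nextPair unpair-k

Restricted : ∀ {Q P} → (Q → Set) → ((q : Q) → P q → Set) → LexSum Q P → Set
Restricted S T (q , p) = S q × T q p

DiagonalPiece : ∀ {Q P} → (ℕ → Q → Set) → ((q : Q) → ℕ → P q → Set) → ℕ → LexSum Q P → Set
DiagonalPiece S T k = Restricted (S (proj₁ (unpair k))) (λ q → T q (proj₂ (unpair k)))

diagonalPiece-cover : ∀ {Q P S T} → (∀ q → ∃ λ n → S n q) → (∀ q (p : P q) → ∃ λ m → T q m p) →
                      ∀ x → ∃ λ k → DiagonalPiece {Q} {P} S T k x
diagonalPiece-cover {S = S} {T} coverS coverT (q , p) with coverS q | coverT q p
... | n , q∈Sₙ | m , p∈Tₘ with unpair-surjective n m
... | k , unpair-k = k , subst (λ nm → S (proj₁ nm) q × T q (proj₂ nm) p) (sym unpair-k) (q∈Sₙ , p∈Tₘ)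

-- Subsets are Boolean-valued so that statements quantifying over them stay in Set,
-- where excluded middle is available; membership is a record so that Y can be
-- inferred from x ∈ˢ Y.
Subset : Set
Subset = ℕ → Bool

infix 4 _∈ˢ_ _⊆ˢ_ _⊑_ _≺_

record _∈ˢ_ (x : ℕ) (Y : Subset) : Set where
  constructor member
  field isMember : T (Y x)

_⊆ˢ_ : Subset → Subset → Set
Y ⊆ˢ Z = ∀ {x} → x ∈ˢ Y → x ∈ˢ Z

⊆ˢ-trans : ∀ {X Y Z} → X ⊆ˢ Y → Y ⊆ˢ Z → X ⊆ˢ Z
⊆ˢ-trans X⊆Y Y⊆Z x∈X = Y⊆Z (X⊆Y x∈X)

_⊑_ : List ℕ → Subset → Set
s ⊑ N = Sorted s × (∀ {x} → x ∈ s → x ∈ˢ N)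

_≺_ : List ℕ → ℕ → Set
s ≺ y = ∀ {x} → x ∈ s → x < y

Infinite : Subset → Set
Infinite Y = ∀ k → ∃ λ x → k < x × x ∈ˢ Y

module Classical (em : ExcludedMiddle 0ℓ) where

  dne : DoubleNegationElimination 0ℓ
  dne = em⇒dne em

  unbounded : ∀ {R : ℕ → Set} → InfinitelyOften R → ∀ k → ∃ λ j → k ≤ j × R j
  unbounded infinitely k = dne λ ∄j → infinitely (k , λ j k≤j Rj → ∄j (j , k≤j , Rj))

  ⟦_⟧ : (ℕ → Set) → Subset
  ⟦ P ⟧ x = ⌊ em {P x} ⌋

  ⟦⟧⁺ : ∀ {P x} → P x → x ∈ˢ ⟦ P ⟧
  ⟦⟧⁺ Px = member (fromWitness Px)

  ⟦⟧⁻ : ∀ {P x} → x ∈ˢ ⟦ P ⟧ → P x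
  ⟦⟧⁻ (member x∈) = toWitness x∈

  infixl 5 _above_
  infixr 6 _∪ˢ_

  _above_ : Subset → ℕ → Subset
  Y above m = ⟦ (λ x → x ∈ˢ Y × m < x) ⟧

  _∪ˢ_ : List ℕ → Subset → Subset
  s ∪ˢ Y = ⟦ (λ y → y ∈ s ⊎ y ∈ˢ Y) ⟧

  module _ {Y : Subset} {m : ℕ} where

    above⁺ : ∀ {x} → x ∈ˢ Y → m < x → x ∈ˢ (Y above m)
    above⁺ x∈Y m<x = ⟦⟧⁺ (x∈Y , m<x)

    above⁻ : ∀ {x} → x ∈ˢ (Y above m) → x ∈ˢ Y × m < x
    above⁻ = ⟦⟧⁻

    above-⊆ : (Y above m) ⊆ˢ Y
    above-⊆ x∈ = proj₁ (above⁻ x∈)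

    above-infinite : Infinite Y → Infinite (Y above m)
    above-infinite inf k with inf (m + k)
    ... | x , m+k<x , x∈Y = x , ≤-<-trans (m≤n+m k m) m+k<x , above⁺ x∈Y (≤-<-trans (m≤m+n m k) m+k<x)

  LeastFrom : Subset → ℕ → ℕ → Set
  LeastFrom Y b n = n ∈ˢ Y × b ≤ n × (∀ {y} → y ∈ˢ Y → b ≤ y → n ≤ y)

  leastFrom : ∀ Y b {x} → x ∈ˢ Y → b ≤ x → ∃ (LeastFrom Y b)
  leastFrom Y b = search (<-wellFounded _)
    where
    search : ∀ {x} → Acc _<_ x → x ∈ˢ Y → b ≤ x → ∃ (LeastFrom Y b)
    search {x} (acc smaller) x∈Y b≤x with em {∃ λ y → y ∈ˢ Y × b ≤ y × y < x}
    ... | yes (y , y∈Y , b≤y , y<x) = search (smaller y<x) y∈Y b≤y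
    ... | no ∄smaller = x , x∈Y , b≤x , λ y∈Y b≤y → ≮⇒≥ λ y<x → ∄smaller (_ , y∈Y , b≤y , y<x)

  module Enumeration (Y : Subset) (inf : Infinite Y) where

    least≥ : ∀ b → ∃ (LeastFrom Y b)
    least≥ b with inf b
    ... | _ , b<x , x∈Y = leastFrom Y b x∈Y (<⇒≤ b<x)

    enum : ℕ → ℕ
    lowerBound : ℕ → ℕ
    enum i = proj₁ (least≥ (lowerBound i))
    lowerBound zero    = zero
    lowerBound (suc i) = suc (enum i)

    enum-∈ : ∀ i → enum i ∈ˢ Y
    enum-∈ i = proj₁ (proj₂ (least≥ (lowerBound i)))

    enum-increasing : StrictlyIncreasing enum
    enum-increasing i = proj₁ (proj₂ (proj₂ (least≥ (lowerBound (suc i)))))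

    enum-least : ∀ i {y} → y ∈ˢ Y → lowerBound i ≤ y → enum i ≤ y
    enum-least i = proj₂ (proj₂ (proj₂ (least≥ (lowerBound i))))

    enum-exhaustive : ∀ i {y} → y ∈ˢ Y → y ≤ enum i → ∃ λ j → j ≤ i × enum j ≡ y
    enum-exhaustive zero    y∈Y y≤ = zero , z≤n , ≤-antisym (enum-least zero y∈Y z≤n) y≤
    enum-exhaustive (suc i) {y} y∈Y y≤ with y ≤? enum i
    ... | yes y≤eᵢ = let j , j≤i , eⱼ≡y = enum-exhaustive i y∈Y y≤eᵢ
                     in j , m≤n⇒m≤1+n j≤i , eⱼ≡y
    ... | no  y≰eᵢ = suc i , ≤-refl , ≤-antisym (enum-least (suc i) y∈Y (≰⇒> y≰eᵢ)) y≤

  open Enumeration using (enum; enum-∈; enum-increasing; enum-exhaustive)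

  record InitialSegment (Y : Subset) (u : List ℕ) : Set where
    field
      sorted : Sorted u
      ⊆Y     : ∀ {x} → x ∈ u → x ∈ˢ Y
      closed : ∀ {x y} → y ∈ˢ Y → x ∈ u → y ≤ x → y ∈ u

  open InitialSegment

  initialSegment-[] : ∀ {Y} → InitialSegment Y []
  initialSegment-[] = record { sorted = [] ; ⊆Y = λ () ; closed = λ _ () }

  initialSegment-enum : ∀ Y inf k → InitialSegment Y (initSeg (enum Y inf) k)
  initialSegment-enum Y inf k = record
    { sorted = sorted-initSeg (enum-increasing Y inf) k
    ; ⊆Y     = λ x∈ → let i , _ , x≡eᵢ = ∈-initSeg⁻ (enum Y inf) k x∈
                     in subst (_∈ˢ Y) (sym x≡eᵢ) (enum-∈ Y inf i)
    ; closed = λ {x} {y} y∈Y x∈ y≤x →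
        let i , i<k , x≡eᵢ = ∈-initSeg⁻ (enum Y inf) k x∈
            j , j≤i , eⱼ≡y = enum-exhaustive Y inf i y∈Y (subst (y ≤_) x≡eᵢ y≤x)
        in subst (_∈ initSeg (enum Y inf) k) eⱼ≡y (∈-initSeg⁺ (enum Y inf) (≤-<-trans j≤i i<k))
    }

  initialSegment-min : ∀ {Y x u y} → InitialSegment Y (x ∷ u) → y ∈ˢ Y → x ≤ y
  initialSegment-min {x = x} {y = y} isu y∈Y =
    ≮⇒≥ λ y<x → y∉ (closed isu y∈Y (here refl) (<⇒≤ y<x)) y<x
    where
    y∉ : y ∈ x ∷ _ → ¬ y < x
    y∉ (here refl)  = <-irrefl refl
    y∉ (there y∈u) = <-asym (head<tail (sorted isu) y∈u)

  initialSegment-tail : ∀ {Y x u} → InitialSegment Y (x ∷ u) → InitialSegment (Y above x) u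
  initialSegment-tail {x = x} isu = record
    { sorted = Linked.tail (sorted isu)
    ; ⊆Y     = λ y∈u → above⁺ (⊆Y isu (there y∈u)) (head<tail (sorted isu) y∈u)
    ; closed = λ y∈ z∈u y≤z → notHead (proj₂ (above⁻ y∈)) (closed isu (above-⊆ y∈) (there z∈u) y≤z)
    }
    where
    notHead : ∀ {y} → x < y → y ∈ x ∷ _ → y ∈ _
    notHead x<y (here refl)  = ⊥-elim (<-irrefl refl x<y)
    notHead _   (there y∈u) = y∈u

  initialSegment-∷ : ∀ {Y x u} → x ∈ˢ Y → (∀ {y} → y ∈ˢ Y → x ≤ y) →
                     InitialSegment (Y above x) u → InitialSegment Y (x ∷ u)
  initialSegment-∷ {Y} {x} {u} x∈Y x≤Y isu = record
    { sorted = sorted-∷ (λ y∈u → proj₂ (above⁻ (⊆Y isu y∈u))) (sorted isu)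
    ; ⊆Y     = λ { (here refl) → x∈Y ; (there y∈u) → above-⊆ (⊆Y isu y∈u) }
    ; closed = closed′
    }
    where
    closed′ : ∀ {z y} → y ∈ˢ Y → z ∈ x ∷ u → y ≤ z → y ∈ x ∷ u
    closed′ {z} {y} y∈Y z∈ y≤z with m≤n⇒m<n∨m≡n (x≤Y y∈Y) | z∈
    ... | inj₂ refl | _         = here refl
    ... | inj₁ x<y  | here refl = ⊥-elim (<⇒≱ x<y y≤z)
    ... | inj₁ x<y  | there z∈u = there (closed isu (above⁺ y∈Y x<y) z∈u y≤z)

  initialSegment-≐ : ∀ {Y Z u} → Y ⊆ˢ Z → Z ⊆ˢ Y → InitialSegment Y u → InitialSegment Z u
  initialSegment-≐ Y⊆Z Z⊆Y isu = record
    { sorted = sorted isu ; ⊆Y = λ x∈u → Y⊆Z (⊆Y isu x∈u) ; closed = λ y∈Z → closed isu (Z⊆Y y∈Z) }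

  initialSegment-take : ∀ {Y w} k → InitialSegment Y w → InitialSegment Y (take k w)
  initialSegment-take {Y} {w} k isw = record
    { sorted = sorted-take k (sorted isw)
    ; ⊆Y     = λ x∈ → ⊆Y isw (∈-take⁻ k x∈)
    ; closed = λ y∈Y x∈ y≤x → take-closed k (sorted isw) (closed isw y∈Y (∈-take⁻ k x∈) y≤x) x∈ y≤x
    }
    where
    take-closed : ∀ k {w x y} → Sorted w → y ∈ w → x ∈ take k w → y ≤ x → y ∈ take k w
    take-closed (suc k) _  (here refl) _           _   = here refl
    take-closed (suc k) ws (there y∈w) (here refl) y≤x = ⊥-elim (<⇒≱ (head<tail ws y∈w) y≤x)
    take-closed (suc k) ws (there y∈w) (there x∈)  y≤x = there (take-closed k (Linked.tail ws) y∈w x∈ y≤x)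

  initialSegment-prefix : ∀ {Y} u v → InitialSegment Y u → InitialSegment Y v →
                          u ≡ take (length u) v ⊎ v ≡ take (length v) u
  initialSegment-prefix []      _       _   _   = inj₁ refl
  initialSegment-prefix (_ ∷ _) []      _   _   = inj₂ refl
  initialSegment-prefix (x ∷ u) (y ∷ v) isu isv
    with ≤-antisym (initialSegment-min isu (⊆Y isv (here refl))) (initialSegment-min isv (⊆Y isu (here refl)))
  ... | refl with initialSegment-prefix u v (initialSegment-tail isu) (initialSegment-tail isv)
  ...   | inj₁ u≡ = inj₁ (cong (x ∷_) u≡)
  ...   | inj₂ v≡ = inj₂ (cong (x ∷_) v≡)

  initialSegment-head : ∀ {Y x u a} → InitialSegment Y (x ∷ u) →
                        a ∈ˢ Y → (∀ {y} → y ∈ˢ Y → a ≤ y) → x ≡ a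
  initialSegment-head isu a∈Y a≤Y = ≤-antisym (initialSegment-min isu a∈Y) (a≤Y (⊆Y isu (here refl)))

  initialSegment-◁ : ∀ {Y a r t} → (a ∷ r) ◁ t → InitialSegment Y (a ∷ t) → InitialSegment Y (a ∷ r)
  initialSegment-◁ (◁-intro k _ _ refl) isat = initialSegment-take (suc k) isat

  module _ {s : List ℕ} {Y : Subset} where

    ∪ˢ-⊆ : ∀ {N} → (∀ {x} → x ∈ s → x ∈ˢ N) → Y ⊆ˢ N → (s ∪ˢ Y) ⊆ˢ N
    ∪ˢ-⊆ s⊆N Y⊆N y∈ = [ s⊆N , Y⊆N ]′ (⟦⟧⁻ y∈)

    ∪ˢ-infinite : Infinite Y → Infinite (s ∪ˢ Y)
    ∪ˢ-infinite inf k = let y , k<y , y∈Y = inf k in y , k<y , ⟦⟧⁺ (inj₂ y∈Y)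

    ∪ˢ-initial : Sorted s → (∀ {x y} → x ∈ s → y ∈ˢ Y → x < y) → InitialSegment (s ∪ˢ Y) s
    ∪ˢ-initial s-sorted s<Y =
      record { sorted = s-sorted ; ⊆Y = λ x∈ → ⟦⟧⁺ (inj₁ x∈) ; closed = closed′ }
      where
      closed′ : ∀ {x y} → y ∈ˢ (s ∪ˢ Y) → x ∈ s → y ≤ x → y ∈ s
      closed′ y∈ x∈s y≤x with ⟦⟧⁻ y∈
      ... | inj₁ y∈s = y∈s
      ... | inj₂ y∈Y = ⊥-elim (<⇒≱ (s<Y x∈s y∈Y) y≤x)

  ∪ˢ⁺ʳ : ∀ {s Y} → Y ⊆ˢ s ∪ˢ Y
  ∪ˢ⁺ʳ y∈Y = ⟦⟧⁺ (inj₂ y∈Y)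

  []∪ˢ⁻ : ∀ {Y} → [] ∪ˢ Y ⊆ˢ Y
  []∪ˢ⁻ y∈ with ⟦⟧⁻ y∈
  ... | inj₂ y∈Y = y∈Y

  ∪ˢ-above⁻ : ∀ {a r Y} → (a ∷ r) ∪ˢ Y above a ⊆ˢ r ∪ˢ Y
  ∪ˢ-above⁻ y∈ with above⁻ y∈
  ... | y∈′ , a<y with ⟦⟧⁻ y∈′
  ...   | inj₁ (here refl)  = ⊥-elim (<-irrefl refl a<y)
  ...   | inj₁ (there y∈r) = ⟦⟧⁺ (inj₁ y∈r)
  ...   | inj₂ y∈Y          = ⟦⟧⁺ (inj₂ y∈Y)

  ∪ˢ-above⁺ : ∀ {a r Y} → Sorted (a ∷ r) → (∀ {y} → y ∈ˢ Y → a < y) →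
              r ∪ˢ Y ⊆ˢ (a ∷ r) ∪ˢ Y above a
  ∪ˢ-above⁺ sorted a<Y y∈ with ⟦⟧⁻ y∈
  ... | inj₁ y∈r = above⁺ (⟦⟧⁺ (inj₁ (there y∈r))) (head<tail sorted y∈r)
  ... | inj₂ y∈Y = above⁺ (⟦⟧⁺ (inj₂ y∈Y)) (a<Y y∈Y)

  ∪ˢ-above-initial : ∀ {s N m} → Sorted s → (∀ {x} → x ∈ s → x ≤ m) →
                     InitialSegment (s ∪ˢ (N above m)) s
  ∪ˢ-above-initial s-sorted s≤m =
    ∪ˢ-initial s-sorted λ x∈s y∈ → ≤-<-trans (s≤m x∈s) (proj₂ (above⁻ y∈))

  -- The Nash-Williams theorem

  record Refinement (M : Subset) (P : Subset → Set) : Set where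
    field
      set      : Subset
      infinite : Infinite set
      ⊆M       : set ⊆ˢ M
      property : P set

  module NashWilliams (F : List ℕ → Set) where

    Accepts : Subset → List ℕ → Set
    Accepts N s = ∀ Y → Infinite Y → Y ⊆ˢ N → (∀ {y} → y ∈ˢ Y → s ≺ y) →
                  ∃ λ u → InitialSegment Y u × F (s ++ u)

    Rejects : Subset → List ℕ → Set
    Rejects N s = ∀ M → Infinite M → M ⊆ˢ N → ¬ Accepts M s

    Decides : Subset → List ℕ → Set
    Decides N s = Accepts N s ⊎ Rejects N s

    DecidesAll : Subset → Set
    DecidesAll N = ∀ {s} → s ⊑ N → Decides N s

    accepts-⊆ : ∀ {N M s} → M ⊆ˢ N → Accepts N s → Accepts M s
    accepts-⊆ M⊆N accepted Y inf Y⊆M = accepted Y inf (⊆ˢ-trans Y⊆M M⊆N)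

    decides-⊆ : ∀ {N M s} → M ⊆ˢ N → Decides N s → Decides M s
    decides-⊆ M⊆N (inj₁ accepted) = inj₁ (accepts-⊆ M⊆N accepted)
    decides-⊆ M⊆N (inj₂ rejected) = inj₂ λ M′ inf M′⊆M → rejected M′ inf (⊆ˢ-trans M′⊆M M⊆N)

    decisive : ∀ M → Infinite M → ∀ s → Refinement M (λ N → Decides N s)
    decisive M inf s with em {∃ λ N → Infinite N × N ⊆ˢ M × Accepts N s}
    ... | yes (N , infN , N⊆M , accepted) =
      record { set = N ; infinite = infN ; ⊆M = N⊆M ; property = inj₁ accepted }
    ... | no ∄accepting =
      record { set = M ; infinite = inf ; ⊆M = λ x∈ → x∈
             ; property = inj₂ λ N infN N⊆M accepted → ∄accepting (N , infN , N⊆M , accepted) }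

    decisiveForAll : ∀ L M → Infinite M → Refinement M (λ N → ∀ {s} → s ∈ L → Decides N s)
    decisiveForAll []      M inf = record { set = M ; infinite = inf ; ⊆M = λ x∈ → x∈ ; property = λ () }
    decisiveForAll (s ∷ L) M inf = record
      { set = set R′ ; infinite = infinite R′ ; ⊆M = ⊆ˢ-trans (⊆M R′) (⊆M R)
      ; property = λ { (here refl) → property R′ ; (there s∈L) → decides-⊆ (⊆M R′) (property R s∈L) }
      }
      where
      open Refinement
      R : Refinement M (λ N → ∀ {s} → s ∈ L → Decides N s)
      R = decisiveForAll L M inf
      R′ : Refinement (set R) (λ N → Decides N s)
      R′ = decisive (set R) (infinite R) s

    -- A fusion sequence M₀ ⊇ M₁ ⊇ ⋯ in which M_{k+1} lies above the chosen point pₖ ∈ Mₖ and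
    -- decides every s ⊆ [0, pₖ]; the set of chosen points then decides all its finite subsets.
    module Fusion (M₀ : Subset) (inf₀ : Infinite M₀) where
      open Refinement

      initial : Refinement M₀ (λ N → Decides N [])
      initial = decisive M₀ inf₀ []

      stage : ℕ → Σ Subset Infinite
      point : ℕ → ℕ
      refine : ∀ k → Refinement (proj₁ (stage k) above point k)
                                (λ N → ∀ {s} → s ∈ sortedBelow (suc (point k)) → Decides N s)
      stage zero    = set initial , infinite initial
      stage (suc k) = set (refine k) , infinite (refine k)
      point k       = proj₁ (proj₂ (stage k) 0)
      refine k      = decisiveForAll (sortedBelow (suc (point k))) _ (above-infinite (proj₂ (stage k)))

      Stage : ℕ → Subset
      Stage k = proj₁ (stage k)

      point-∈ : ∀ k → point k ∈ˢ Stage k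
      point-∈ k = proj₂ (proj₂ (proj₂ (stage k) 0))

      stage-step : ∀ k → Stage (suc k) ⊆ˢ Stage k
      stage-step k = ⊆ˢ-trans (⊆M (refine k)) above-⊆

      stage-antitone : ∀ {i j} → i ≤ j → Stage j ⊆ˢ Stage i
      stage-antitone i≤j with m≤n⇒m<n∨m≡n i≤j
      ... | inj₂ refl = λ x∈ → x∈
      stage-antitone {j = suc j} _ | inj₁ (s≤s i≤j) = ⊆ˢ-trans (stage-step j) (stage-antitone i≤j)

      point-increasing : StrictlyIncreasing point
      point-increasing k = proj₂ (above⁻ (⊆M (refine k) (point-∈ (suc k))))

      fused : Subset
      fused = ⟦ (λ x → ∃ λ k → point k ≡ x) ⟧

      fused-⊆₀ : fused ⊆ˢ Stage 0
      fused-⊆₀ x∈ with ⟦⟧⁻ x∈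
      ... | k , refl = stage-antitone {j = k} z≤n (point-∈ k)

      fused-⊆ : fused ⊆ˢ M₀
      fused-⊆ = ⊆ˢ-trans fused-⊆₀ (⊆M initial)

      fused-infinite : Infinite fused
      fused-infinite k = point (suc k) , increasing-≥ point-increasing (suc k) , ⟦⟧⁺ (suc k , refl)

      fused-above : ∀ k {x} → x ∈ˢ fused → point k < x → x ∈ˢ Stage (suc k)
      fused-above k x∈ pₖ<x with ⟦⟧⁻ x∈
      ... | j , refl with k <? j
      ...   | yes k<j = stage-antitone k<j (point-∈ j)
      ...   | no  k≮j =
        ⊥-elim (<⇒≱ pₖ<x (increasing-≤ point-increasing (≮⇒≥ k≮j)))

      fused-decidesAll : DecidesAll fused
      fused-decidesAll {s} = decide (reverseView s)
        where
        decide : ∀ {s} → Reverse s → s ⊑ fused → Decides fused s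
        decide []             _            = decides-⊆ fused-⊆₀ (property initial)
        decide (s′ ∶ _ ∶ʳ m) (sorted , ⊆N) with ⟦⟧⁻ (⊆N (∈-++⁺ʳ s′ (here refl)))
        ... | k , refl with property (refine k) (sortedBelow-complete _ sorted ≤pₖ)
          where
          ≤pₖ : ∀ {x} → x ∈ s′ ∷ʳ point k → x < suc (point k)
          ≤pₖ x∈ with ∈-++⁻ s′ x∈
          ... | inj₁ x∈s′        = s≤s (<⇒≤ (proj₂ (sorted-∷ʳ⁻ s′ sorted) x∈s′))
          ... | inj₂ (here refl) = ≤-refl
        ...   | inj₁ accepted = inj₁ λ Y inf Y⊆N s≺Y →
                  accepted Y inf (λ y∈ → fused-above k (Y⊆N y∈) (s≺Y y∈ (∈-++⁺ʳ s′ (here refl))))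
                           s≺Y
        ...   | inj₂ rejected = inj₂ λ M inf M⊆N accepted →
                  rejected (M above point k) (above-infinite inf)
                           (λ x∈ → fused-above k (M⊆N (above-⊆ x∈)) (proj₂ (above⁻ x∈)))
                           (accepts-⊆ above-⊆ accepted)

    rejects⇒¬F : ∀ {N s} → Infinite N → Rejects N s → ¬ F s
    rejects⇒¬F {N} {s} inf rejected Fs =
      rejected N inf (λ x∈ → x∈) λ Y _ _ _ → [] , initialSegment-[] , subst F (sym (++-identityʳ s)) Fs

    module Rejection (N : Subset) (inf : Infinite N) (decided : DecidesAll N) where

      EventuallyRejected : List ℕ → Set
      EventuallyRejected s = ∃ λ b → ∀ {n} → n ∈ˢ N → b < n → Rejects N (s ∷ʳ n)

      -- If infinitely many one-point extensions of s were accepted, they would together accept s.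
      rejects⇒eventuallyRejected : ∀ {s} → s ⊑ N → Rejects N s → EventuallyRejected s
      rejects⇒eventuallyRejected {s} (sorted , ⊆N) rejected with em {EventuallyRejected s}
      ... | yes eventually = eventually
      ... | no ¬eventually = ⊥-elim (rejected Accepted Accepted-infinite Accepted-⊆ Accepted-accepts)
        where
        Accepted : Subset
        Accepted = ⟦ (λ n → n ∈ˢ N × s ≺ n × Accepts N (s ∷ʳ n)) ⟧

        Accepted-⊆ : Accepted ⊆ˢ N
        Accepted-⊆ n∈ = proj₁ (⟦⟧⁻ n∈)

        ⊑N : ∀ {n} → n ∈ˢ N → s ≺ n → (s ∷ʳ n) ⊑ N
        ⊑N n∈N s≺n =
          sorted-∷ʳ s≺n sorted , λ x∈ → [ ⊆N , (λ { (here refl) → n∈N }) ]′ (∈-++⁻ s x∈)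

        Accepted-infinite : Infinite Accepted
        Accepted-infinite k with em {∃ λ n → n ∈ˢ N × k + sum s < n × ¬ Rejects N (s ∷ʳ n)}
        ... | no ∄n = ⊥-elim (¬eventually (k + sum s , λ n∈N b<n →
                        dne λ ¬rejected → ∄n (_ , n∈N , b<n , ¬rejected)))
        ... | yes (n , n∈N , k+Σs<n , ¬rejected) =
          n , ≤-<-trans (m≤m+n k (sum s)) k+Σs<n ,
          ⟦⟧⁺ (n∈N , s≺n , [ (λ accepted → accepted) , (λ rejected → ⊥-elim (¬rejected rejected)) ]′
                               (decided (⊑N n∈N s≺n)))
          where
          s≺n : s ≺ n
          s≺n x∈s = ≤-<-trans (≤-trans (∈⇒≤sum x∈s) (m≤n+m (sum s) k)) k+Σs<n

        Accepted-accepts : Accepts Accepted s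
        Accepted-accepts Y infY Y⊆A s≺Y with leastFrom Y 0 (proj₂ (proj₂ (infY 0))) z≤n
        ... | n , n∈Y , _ , n≤Y with ⟦⟧⁻ (Y⊆A n∈Y)
        ...   | _ , _ , accepted with accepted (Y above n) (above-infinite infY)
                                        (λ y∈ → Accepted-⊆ (Y⊆A (above-⊆ y∈))) s∷ʳn≺
          where
          s∷ʳn≺ : ∀ {y} → y ∈ˢ (Y above n) → (s ∷ʳ n) ≺ y
          s∷ʳn≺ y∈ x∈ with ∈-++⁻ s x∈
          ... | inj₁ x∈s         = s≺Y (above-⊆ y∈) x∈s
          ... | inj₂ (here refl) = proj₂ (above⁻ y∈)
        ...     | u , isu , F[s∷ʳn++u] =
          n ∷ u , initialSegment-∷ n∈Y (λ y∈ → n≤Y y∈ z≤n) isu ,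
          subst F (++-assoc s [ n ] u) F[s∷ʳn++u]

      -- Thin N out to R = {p₀ < p₁ < ⋯} with pₖ beyond the rejection bounds of all s ⊆ [0, pₖ₋₁]:
      -- then every finite subset of R is rejected, by induction on its last element.
      module RejectingSubset (rejected[] : Rejects N []) where

        bound : List ℕ → ℕ
        bound s with em {EventuallyRejected s}
        ... | yes (b , _) = b
        ... | no _        = 0

        bound-rejects : ∀ {s} → EventuallyRejected s →
                        ∀ {n} → n ∈ˢ N → bound s < n → Rejects N (s ∷ʳ n)
        bound-rejects {s} eventually with em {EventuallyRejected s}
        ... | yes (_ , rejects) = rejects
        ... | no ¬eventually    = ⊥-elim (¬eventually eventually)

        threshold : ℕ → ℕ
        boundsBelow : ℕ → ℕ
        p : ℕ → ℕ
        threshold zero    = zero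
        threshold (suc k) = suc (p k)
        boundsBelow k     = sum (map bound (sortedBelow (threshold k)))
        p k               = proj₁ (inf (threshold k + boundsBelow k))

        p-∈ : ∀ k → p k ∈ˢ N
        p-∈ k = proj₂ (proj₂ (inf (threshold k + boundsBelow k)))

        p-large : ∀ k → threshold k + boundsBelow k < p k
        p-large k = proj₁ (proj₂ (inf (threshold k + boundsBelow k)))

        p-increasing : StrictlyIncreasing p
        p-increasing k = ≤-trans (m≤m+n (suc (p k)) _) (<⇒≤ (p-large (suc k)))

        R : Subset
        R = ⟦ (λ x → ∃ λ k → p k ≡ x) ⟧

        R-⊆ : R ⊆ˢ N
        R-⊆ x∈ with ⟦⟧⁻ x∈
        ... | k , refl = p-∈ k

        R-infinite : Infinite R
        R-infinite k = p (suc k) , increasing-≥ p-increasing (suc k) , ⟦⟧⁺ (suc k , refl)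

        below-threshold : ∀ k {x} → x ∈ˢ R → x < p k → x < threshold k
        below-threshold k x∈ x<pₖ with ⟦⟧⁻ x∈
        below-threshold zero    _ pⱼ<p₀ | j , refl =
          ⊥-elim (<⇒≱ pⱼ<p₀ (increasing-≤ p-increasing {j = j} z≤n))
        below-threshold (suc k) _ pⱼ<pₖ₊₁ | j , refl with j ≤? k
        ... | yes j≤k = s≤s (increasing-≤ p-increasing j≤k)
        ... | no  j≰k =
          ⊥-elim (<⇒≱ pⱼ<pₖ₊₁ (increasing-≤ p-increasing (≰⇒> j≰k)))

        R-rejects : ∀ {s} → s ⊑ R → Rejects N s
        R-rejects {s} = rejects (reverseView s)
          where
          rejects : ∀ {s} → Reverse s → s ⊑ R → Rejects N s
          rejects []               _            = rejected[]
          rejects (s′ ∶ s′ʳ ∶ʳ x) (sorted , ⊆R) with ⟦⟧⁻ (⊆R (∈-++⁺ʳ s′ (here refl)))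
          ... | k , refl =
            bound-rejects (rejects⇒eventuallyRejected (sorted′ , λ y∈ → R-⊆ (⊆R′ y∈))
                                                      (rejects s′ʳ (sorted′ , ⊆R′)))
                          (p-∈ k) (≤-<-trans (≤-trans bound≤ (m≤n+m _ (threshold k))) (p-large k))
            where
            sorted′ : Sorted s′
            sorted′ = proj₁ (sorted-∷ʳ⁻ s′ sorted)
            ⊆R′ : ∀ {y} → y ∈ s′ → y ∈ˢ R
            ⊆R′ y∈ = ⊆R (∈-++⁺ˡ y∈)
            bound≤ : bound s′ ≤ boundsBelow k
            bound≤ = ∈⇒≤sum (∈-map⁺ bound (sortedBelow-complete (threshold k) sorted′
                       λ y∈ → below-threshold k (⊆R′ y∈) (proj₂ (sorted-∷ʳ⁻ s′ sorted) y∈)))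

    Meets : Subset → Set
    Meets N = ∀ Y → Infinite Y → Y ⊆ˢ N → ∃ λ u → InitialSegment Y u × F u

    Avoids : Subset → Set
    Avoids N = ∀ {s} → s ⊑ N → ¬ F s

    nashWilliams : ∀ M → Infinite M → Refinement M (λ N → Meets N ⊎ Avoids N)
    nashWilliams M inf = conclude (fused-decidesAll ([] , λ ()))
      where
      open Fusion M inf
      conclude : Decides fused [] → Refinement M (λ N → Meets N ⊎ Avoids N)
      conclude (inj₁ accepted) = record
        { set = fused ; infinite = fused-infinite ; ⊆M = fused-⊆
        ; property = inj₁ λ Y infY Y⊆N → accepted Y infY Y⊆N (λ _ ())
        }
      conclude (inj₂ rejected) = record
        { set = R ; infinite = R-infinite ; ⊆M = ⊆ˢ-trans R-⊆ fused-⊆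
        ; property = inj₂ λ s⊑R → rejects⇒¬F fused-infinite (R-rejects s⊑R)
        }
        where
        open Rejection fused fused-infinite fused-decidesAll
        open RejectingSubset rejected

  -- Barriers

  module Barrier {B : List ℕ → Set} (bar : IsBarrier B) where
    open IsBarrier bar

    ⋃B : Subset
    ⋃B = ⟦ (λ x → ∃ λ s → B s × x ∈ s) ⟧

    []∉B : ¬ B []
    []∉B []∈B = infinite ([ [] ] , λ s s∈B → here (sym (antichain [] s []∈B s∈B λ _ ())))

    ⋃B-infinite : Infinite ⋃B
    ⋃B-infinite k with em {∃ λ x → k < x × x ∈ˢ ⋃B}
    ... | yes large = large
    ... | no ∄large = ⊥-elim (infinite (sortedBelow (suc k) , λ s s∈B →
          sortedBelow-complete (suc k) (members-sorted s s∈B)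
            λ x∈s → s≤s (≮⇒≥ λ k<x → ∄large (_ , k<x , ⟦⟧⁺ (s , s∈B , x∈s)))))

    initialSegmentInB : ∀ Y → Infinite Y → Y ⊆ˢ ⋃B → ∃ λ u → InitialSegment Y u × B u
    initialSegmentInB Y inf Y⊆⋃B with covering (enum Y inf) (enum-increasing Y inf)
                                       (λ i → ⟦⟧⁻ (Y⊆⋃B (enum-∈ Y inf i)))
    ... | k , segment∈B = initSeg (enum Y inf) k , initialSegment-enum Y inf k , segment∈B

    prefix⇒⊆ : ∀ {u v} → u ≡ take (length u) v → u ⊆ₗ v
    prefix⇒⊆ {u} {v} u≡ x x∈u = ∈-take⁻ (length u) (subst (x ∈_) u≡ x∈u)

    initialSegmentInB-unique : ∀ {Y u v} → InitialSegment Y u → InitialSegment Y v → B u → B v → u ≡ v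
    initialSegmentInB-unique {u = u} {v} isu isv u∈B v∈B with initialSegment-prefix u v isu isv
    ... | inj₁ u≡ = antichain u v u∈B v∈B (prefix⇒⊆ u≡)
    ... | inj₂ v≡ = sym (antichain v u v∈B u∈B (prefix⇒⊆ v≡))

    Restrict : Subset → List ℕ → Set
    Restrict N s = B s × (∀ {x} → x ∈ s → x ∈ˢ N)

    restrict-barrier : ∀ N → Infinite N → N ⊆ˢ ⋃B → IsBarrier (Restrict N)
    restrict-barrier N inf N⊆⋃B = record
      { members-sorted = λ s s∈ → members-sorted s (proj₁ s∈)
      ; infinite       = restrict-infinite
      ; antichain      = λ s t s∈ t∈ → antichain s t (proj₁ s∈) (proj₁ t∈)
      ; covering       = restrict-covering
      }
      where
      restrict-infinite : ¬ FiniteFamily (Restrict N)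
      restrict-infinite (L , complete) = noMemberBeyond (initialSegmentInB (N above bound) (above-infinite inf)
                                                                      (⊆ˢ-trans above-⊆ N⊆⋃B))
        where
        open InitialSegment
        bound : ℕ
        bound = sum (map sum L)
        noMemberBeyond : ¬ (∃ λ u → InitialSegment (N above bound) u × B u)
        noMemberBeyond ([]    , _   , []∈B)  = []∉B []∈B
        noMemberBeyond (x ∷ u , isu , x∷u∈B) = <⇒≱ bound<x x≤bound
          where
          bound<x : bound < x
          bound<x = proj₂ (above⁻ (⊆Y isu (here refl)))
          x≤bound : x ≤ bound
          x≤bound = ∈∈⇒≤sum (here refl) (complete (x ∷ u) (x∷u∈B , λ y∈ → above-⊆ (⊆Y isu y∈)))
      restrict-covering : ∀ f → StrictlyIncreasing f → (∀ i → ∃ λ s → Restrict N s × f i ∈ s) →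
                          ∃ λ k → Restrict N (initSeg f k)
      restrict-covering f f↑ covered
        with covering f f↑ (λ i → let s , s∈ , fᵢ∈s = covered i in s , proj₁ s∈ , fᵢ∈s)
      ... | k , segment∈B = k , segment∈B , λ x∈ →
            let i , _ , x≡fᵢ = ∈-initSeg⁻ f k x∈
                s , s∈ , fᵢ∈s = covered i
            in subst (_∈ˢ N) (sym x≡fᵢ) (proj₂ s∈ fᵢ∈s)

    ◁-successor : ∀ Y → Infinite Y → Y ⊆ˢ ⋃B → ∀ {a u} → InitialSegment Y (a ∷ u) → B (a ∷ u) →
                  ∃ λ v → InitialSegment (Y above a) v × B v × (a ∷ u) ◁ v
    ◁-successor Y inf Y⊆⋃B {a} {u} isu a∷u∈B =
      successor (initialSegmentInB (Y above a) (above-infinite inf) (⊆ˢ-trans above-⊆ Y⊆⋃B))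
      where
      open InitialSegment
      successor : (∃ λ v → InitialSegment (Y above a) v × B v) →
                  ∃ λ v → InitialSegment (Y above a) v × B v × (a ∷ u) ◁ v
      successor ([]    , _   , []∈B)  = ⊥-elim ([]∉B []∈B)
      successor (b ∷ v , isv , b∷v∈B) = b ∷ v , isv , b∷v∈B , a∷u◁b∷v
        where
        a<b : a < b
        a<b = proj₂ (above⁻ (⊆Y isv (here refl)))
        ⊈ : ¬ (b ∷ v) ⊆ₗ (a ∷ u)
        ⊈ b∷v⊆ with antichain (b ∷ v) (a ∷ u) b∷v∈B a∷u∈B b∷v⊆
        ... | refl = <-irrefl refl a<b
        a∷u◁b∷v : (a ∷ u) ◁ (b ∷ v)
        a∷u◁b∷v with initialSegment-prefix u (b ∷ v) (initialSegment-tail isu) isv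
        ... | inj₂ b∷v≡ = ⊥-elim (⊈ λ x x∈ → there (prefix⇒⊆ b∷v≡ x x∈))
        ... | inj₁ u≡ with length u <? length (b ∷ v)
        ...   | yes shorter = ◁-intro (length u) a<b shorter u≡
        ...   | no  longer  = ⊥-elim (⊈ λ x x∈ → there (subst (x ∈_) (sym u≡b∷v) x∈))
          where
          u≡b∷v : u ≡ b ∷ v
          u≡b∷v = trans u≡ (take-all (length u) (b ∷ v) (≮⇒≥ longer))

  -- Ramsey's theorem for pairs

  AllPairsIn : Subset → (ℕ → ℕ → Set) → Set
  AllPairsIn N R = ∀ {i j} → i ∈ˢ N → j ∈ˢ N → i < j → R i j

  ramsey² : (R : ℕ → ℕ → Set) →
            ∃ λ N → Infinite N × (AllPairsIn N R ⊎ AllPairsIn N (λ i j → ¬ R i j))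
  ramsey² R with nashWilliams full full-infinite
    where
    full : Subset
    full _ = Bool.true
    full-infinite : Infinite full
    full-infinite k = suc k , ≤-refl , member _
    open NashWilliams (λ u → ∃₂ λ i j → u ≡ i ∷ j ∷ [] × R i j)
  ... | record { set = N ; infinite = inf ; property = inj₂ avoids } =
    N , inf , inj₂ λ i∈N j∈N i<j Rij →
      avoids ((i<j ∷ [-]) , λ { (here refl) → i∈N ; (there (here refl)) → j∈N }) (_ , _ , refl , Rij)
  ... | record { set = N ; infinite = inf ; property = inj₁ meets } = N , inf , inj₁ pair
    where
    pair : AllPairsIn N R
    pair {i} {j} i∈N j∈N i<j
      with meets ((i ∷ j ∷ []) ∪ˢ (N above j)) (∪ˢ-infinite (above-infinite inf))
                 (∪ˢ-⊆ (λ { (here refl) → i∈N ; (there (here refl)) → j∈N }) above-⊆)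
    ... | u , isu , (_ , _ , refl , R′)
      with initialSegment-prefix _ (i ∷ j ∷ []) isu
             (∪ˢ-above-initial (i<j ∷ [-]) λ { (here refl) → <⇒≤ i<j ; (there (here refl)) → ≤-refl })
    ...   | inj₁ refl = R′
    ...   | inj₂ refl = R′

  allPairsIn-≢ : ∀ {N R} → AllPairsIn N R → (∀ {i j} → R i j → R j i) →
                 ∀ {i j} → i ∈ˢ N → j ∈ˢ N → ¬ i ≡ j → R i j
  allPairsIn-≢ pairs sym-R {i} {j} i∈N j∈N i≢j with <-cmp i j
  ... | tri< i<j _ _ = pairs i∈N j∈N i<j
  ... | tri≈ _ i≡j _ = ⊥-elim (i≢j i≡j)
  ... | tri> _ _ j<i = sym-R (pairs j∈N i∈N j<i)

  -- Lexicographic sums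

  module LexicographicSum {Q : Set} (_≤Q_ : Q → Q → Set) (P : Q → Set)
                          (_≤P_ : (q : Q) → P q → P q → Set) where

    _≤L_ : LexSum Q P → LexSum Q P → Set
    _≤L_ = LexLe _≤Q_ P _≤P_

    at : ∀ {q₀} (x : LexSum Q P) → proj₁ x ≡ q₀ → P q₀
    at (_ , p) refl = p

    module _ {q₀ : Q} where

      at-≤⇒≤L : ∀ x y (x≡ : proj₁ x ≡ q₀) (y≡ : proj₁ y ≡ q₀) →
                _≤P_ q₀ (at x x≡) (at y y≡) → x ≤L y
      at-≤⇒≤L _ _ refl refl p≤p′ = inj₂ (refl , p≤p′)

      ≤L⇒at-≤ : ∀ x y (x≡ : proj₁ x ≡ q₀) (y≡ : proj₁ y ≡ q₀) →
                x ≤L y → _≤P_ q₀ (at x x≡) (at y y≡)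
      ≤L⇒at-≤ _ _ refl refl (inj₁ (_ , q₀≢q₀)) = ⊥-elim (q₀≢q₀ refl)
      ≤L⇒at-≤ _ _ refl refl (inj₂ (refl , p≤p′)) = p≤p′

      at-injective : ∀ x y (x≡ : proj₁ x ≡ q₀) (y≡ : proj₁ y ≡ q₀) →
                     at x x≡ ≡ at y y≡ → x ≡ y
      at-injective _ _ refl refl refl = refl

    antichainInQOrFibre : HasInfiniteAntichain (LexSum Q P) _≤L_ →
                          HasInfiniteAntichain Q _≤Q_ ⊎ ∃ λ q₀ → HasInfiniteAntichain (P q₀) (_≤P_ q₀)
    antichainInQOrFibre (g , antichain) with ramsey² (λ i j → proj₁ (g i) ≡ proj₁ (g j))
    ... | N , inf , homogeneous = split homogeneous
      where
      e : ℕ → ℕ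
      e = enum N inf
      e-injective : ∀ {i j} → ¬ i ≡ j → ¬ e i ≡ e j
      e-injective = increasing-injective (enum-increasing N inf)
      q : ℕ → Q
      q i = proj₁ (g (e i))
      split : AllPairsIn N (λ i j → proj₁ (g i) ≡ proj₁ (g j)) ⊎
              AllPairsIn N (λ i j → ¬ proj₁ (g i) ≡ proj₁ (g j)) →
              HasInfiniteAntichain Q _≤Q_ ⊎ ∃ λ q₀ → HasInfiniteAntichain (P q₀) (_≤P_ q₀)
      split (inj₁ same) = inj₂ (q 0 , (λ i → at (g (e i)) (q≡q₀ i)) , λ i j i≢j pᵢ≤pⱼ →
          antichain (e i) (e j) (e-injective i≢j)
                    (at-≤⇒≤L (g (e i)) (g (e j)) (q≡q₀ i) (q≡q₀ j) pᵢ≤pⱼ))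
        where
        q≡q₀ : ∀ i → q i ≡ q 0
        q≡q₀ zero    = refl
        q≡q₀ (suc i) = allPairsIn-≢ same sym (enum-∈ N inf (suc i)) (enum-∈ N inf 0) (e-injective λ ())
      split (inj₂ distinct) = inj₁ (q , λ i j i≢j qᵢ≤qⱼ →
          antichain (e i) (e j) (e-injective i≢j)
            (inj₁ (qᵢ≤qⱼ , allPairsIn-≢ distinct (λ ≢ ≡ → ≢ (sym ≡))
                                        (enum-∈ N inf i) (enum-∈ N inf j) (e-injective i≢j))))

    lexSum-antichainFree : ¬ HasInfiniteAntichain Q _≤Q_ → (∀ q → ¬ HasInfiniteAntichain (P q) (_≤P_ q)) →
                           ¬ HasInfiniteAntichain (LexSum Q P) _≤L_
    lexSum-antichainFree noAntichainQ noAntichainP =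
      [ noAntichainQ , uncurry noAntichainP ]′ ∘ antichainInQOrFibre

    module DescendingSequence (posetQ : IsPoset Q _≤Q_) (g : ℕ → LexSum Q P)
                              (descending : ∀ i → Strict _≤L_ (g (suc i)) (g i)) where
      open IsPartialOrder posetQ using (reflexive; antisym) renaming (trans to ≤Q-trans)

      q : ℕ → Q
      q i = proj₁ (g i)

      q-step : ∀ i → q (suc i) ≤Q q i
      q-step i with proj₁ (descending i)
      ... | inj₁ (q≤q′ , _) = q≤q′
      ... | inj₂ (q≡q′ , _) = reflexive q≡q′

      q-antitone : ∀ {i j} → i ≤ j → q j ≤Q q i
      q-antitone i≤j with m≤n⇒m<n∨m≡n i≤j
      ... | inj₂ refl = reflexive refl
      q-antitone {j = suc j} _ | inj₁ (s≤s i≤j) = ≤Q-trans (q-step j) (q-antitone i≤j)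

      DropsAt : ℕ → Set
      DropsAt j = ¬ q (suc j) ≡ q j

      -- Each drop is a strict step of q, and q never goes up in between.
      drops⇒descendingQ : (∀ k → ∃ λ j → k ≤ j × DropsAt j) → HasInfiniteDescending Q _≤Q_
      drops⇒descendingQ drops = q ∘ js , λ i → strict i
        where
        js : ℕ → ℕ
        js zero    = proj₁ (drops 0)
        js (suc i) = proj₁ (drops (suc (js i)))
        dropsAt : ∀ i → DropsAt (js i)
        dropsAt zero    = proj₂ (proj₂ (drops 0))
        dropsAt (suc i) = proj₂ (proj₂ (drops (suc (js i))))
        strict : ∀ i → Strict _≤Q_ (q (js (suc i))) (q (js i))
        strict i = ≤Q-trans below (q-step (js i)) ,
                   λ q≡ → dropsAt i (antisym (q-step (js i)) (subst (_≤Q q (suc (js i))) q≡ below))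
          where
          below : q (js (suc i)) ≤Q q (suc (js i))
          below = q-antitone (proj₁ (proj₂ (drops (suc (js i)))))

      finitelyManyDrops⇒descendingFibre : FinitelyOften DropsAt →
                                          ∃ λ q₀ → HasInfiniteDescending (P q₀) (_≤P_ q₀)
      finitelyManyDrops⇒descendingFibre (k , noDrop) =
        q k , (λ d → at (g (d + k)) (constant d)) , λ d →
          ≤L⇒at-≤ (g (suc d + k)) (g (d + k)) (constant (suc d)) (constant d) (proj₁ (descending (d + k))) ,
          λ p≡ → proj₂ (descending (d + k)) (at-injective _ _ (constant (suc d)) (constant d) p≡)
        where
        constant : ∀ d → q (d + k) ≡ q k
        constant zero    = refl
        constant (suc d) = trans (dne (noDrop (d + k) (m≤n+m k d))) (constant d)

      descendingInQOrFibre : HasInfiniteDescending Q _≤Q_ ⊎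
                             ∃ λ q₀ → HasInfiniteDescending (P q₀) (_≤P_ q₀)
      descendingInQOrFibre with em {FinitelyOften DropsAt}
      ... | yes finitely  = inj₂ (finitelyManyDrops⇒descendingFibre finitely)
      ... | no infinitely = inj₁ (drops⇒descendingQ (unbounded infinitely))

    lexSum-descendingFree : IsPoset Q _≤Q_ → ¬ HasInfiniteDescending Q _≤Q_ →
                            (∀ q → ¬ HasInfiniteDescending (P q) (_≤P_ q)) →
                            ¬ HasInfiniteDescending (LexSum Q P) _≤L_
    lexSum-descendingFree posetQ noDescendingQ noDescendingP (g , descending) =
      [ noDescendingQ , uncurry noDescendingP ]′ (DescendingSequence.descendingInQOrFibre posetQ g descending)

    module _ {S : Q → Set} {T : (q : Q) → P q → Set} {q₀ : Q} where

      fibre : (x : Σ (LexSum Q P) (Restricted S T)) → proj₁ (proj₁ x) ≡ q₀ → Σ (P q₀) (T q₀)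
      fibre ((_ , p) , _ , t) refl = p , t

      fibre-≤⇒≤L : ∀ x y (x≡ : proj₁ (proj₁ x) ≡ q₀) (y≡ : proj₁ (proj₁ y) ≡ q₀) →
                   Induced (_≤P_ q₀) (T q₀) (fibre x x≡) (fibre y y≡) → proj₁ x ≤L proj₁ y
      fibre-≤⇒≤L _ _ refl refl p≤p′ = inj₂ (refl , p≤p′)

    module RestrictedLexSumBqo (S : Q → Set) (T : (q : Q) → P q → Set)
                               (bqoS : IsBqo (Σ Q S) (Induced _≤Q_ S))
                               (bqoT : ∀ q → IsBqo (Σ (P q) (T q)) (Induced (_≤P_ q) (T q)))
                               {B : List ℕ → Set} (bar : IsBarrier B)
                               (f : (s : List ℕ) → B s → Σ (LexSum Q P) (Restricted S T)) where
      open IsBarrier bar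
      open Barrier bar

      Goal : Set
      Goal = Good (Induced _≤L_ (Restricted S T)) B f

      -- f may depend on the proof of B s; evaluating it at a proof chosen once and for all
      -- makes its first coordinate a function of the list s alone.
      canonical : ∀ s → B s → B s
      canonical s s∈B with em {B s}
      ... | yes s∈B′ = s∈B′
      ... | no  s∉B  = ⊥-elim (s∉B s∈B)

      canonical-unique : ∀ s (b b′ : B s) → canonical s b ≡ canonical s b′
      canonical-unique s b _ with em {B s}
      ... | yes _   = refl
      ... | no  s∉B = ⊥-elim (s∉B b)

      f̂ : (s : List ℕ) → B s → Σ (LexSum Q P) (Restricted S T)
      f̂ s b = f s (canonical s b)

      q : ∀ s → B s → Q
      q s b = proj₁ (proj₁ (f̂ s b))

      q-irrelevant : ∀ {s t} → s ≡ t → (b : B s) (b′ : B t) → q s b ≡ q t b′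
      q-irrelevant {s} refl b b′ = cong (λ c → proj₁ (proj₁ (f s c))) (canonical-unique s b b′)

      -- Colours the members a ∷ t = (a ∷ r) ∪ t of the square barrier B², where (a ∷ r) ◁ t in B.
      SameQ : List ℕ → Set
      SameQ u = ∃ λ a → ∃ λ r → ∃ λ t → Σ (B (a ∷ r)) λ b → Σ (B t) λ b′ →
                (a ∷ r) ◁ t × u ≡ a ∷ t × q (a ∷ r) b ≡ q t b′

      open NashWilliams SameQ using (Meets; Avoids; nashWilliams)

      goodWhenAvoids : ∀ N → Infinite N → N ⊆ˢ ⋃B → Avoids N → Goal
      goodWhenAvoids N inf N⊆⋃B avoids
        with bqoS (Restrict N) (restrict-barrier N inf N⊆⋃B)
                  (λ s s∈ → q s (proj₁ s∈) , proj₁ (proj₂ (f̂ s (proj₁ s∈))))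
      ... | s , t , s∈ , t∈ , s◁t , qₛ≤qₜ =
        s , t , canonical s (proj₁ s∈) , canonical t (proj₁ t∈) , s◁t ,
        inj₁ (qₛ≤qₜ , qₛ≢qₜ s◁t s∈ t∈)
        where
        qₛ≢qₜ : ∀ {s t} → s ◁ t → (s∈ : Restrict N s) (t∈ : Restrict N t) →
                ¬ q s (proj₁ s∈) ≡ q t (proj₁ t∈)
        qₛ≢qₜ {[]}    ()
        qₛ≢qₜ {a ∷ r} a∷r◁t (a∷r∈B , a∷r⊆N) (t∈B , t⊆N) q≡ =
          avoids (◁-sorted a∷r◁t (members-sorted _ t∈B) ,
                  λ { (here refl) → a∷r⊆N (here refl) ; (there x∈t) → t⊆N x∈t })
                 (a , r , _ , a∷r∈B , t∈B , a∷r◁t , refl , q≡)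

      sameQ-segment : ∀ {Y a r t} (a∷r∈B : B (a ∷ r)) (t∈B : B t) → (a ∷ r) ◁ t →
                      InitialSegment Y (a ∷ t) → ∀ {u} → InitialSegment Y u → SameQ u →
                      q (a ∷ r) a∷r∈B ≡ q t t∈B
      sameQ-segment a∷r∈B t∈B a∷r◁t isat isu (_ , _ , _ , b , b′ , a∷r′◁t′ , refl , q≡)
        with initialSegmentInB-unique (initialSegment-◁ a∷r◁t isat) (initialSegment-◁ a∷r′◁t′ isu)
                                      a∷r∈B b
      ... | refl with initialSegmentInB-unique (initialSegment-tail isat) (initialSegment-tail isu) t∈B b′
      ...   | refl = trans (q-irrelevant refl a∷r∈B b) (trans q≡ (q-irrelevant refl b′ t∈B))

      module WhenMeets (N : Subset) (inf : Infinite N) (N⊆⋃B : N ⊆ˢ ⋃B) (meets : Meets N) where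

        ◁-sameQ : ∀ {s t} → s ◁ t → (s∈ : Restrict N s) (t∈ : Restrict N t) →
                  q s (proj₁ s∈) ≡ q t (proj₁ t∈)
        ◁-sameQ {[]}    ()
        ◁-sameQ {a ∷ r} {t} a∷r◁t (a∷r∈B , a∷r⊆N) (t∈B , t⊆N) =
          let _ , isu , sameQ = meets Y (∪ˢ-infinite (above-infinite inf)) (∪ˢ-⊆ a∷t⊆N above-⊆)
          in sameQ-segment a∷r∈B t∈B a∷r◁t isat isu sameQ
          where
          Y : Subset
          Y = (a ∷ t) ∪ˢ (N above sum (a ∷ t))
          a∷t⊆N : ∀ {x} → x ∈ a ∷ t → x ∈ˢ N
          a∷t⊆N (here refl)  = a∷r⊆N (here refl)
          a∷t⊆N (there x∈t) = t⊆N x∈t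
          isat : InitialSegment Y (a ∷ t)
          isat = ∪ˢ-above-initial (◁-sorted a∷r◁t (members-sorted t t∈B)) ∈⇒≤sum

        -- Walking from r ∪ (N above m) to N above m along ◁-successors, one element of r at a time.
        module TowardsTail (m : ℕ) (w : List ℕ) (isw : InitialSegment (N above m) w) (w∈B : B w) where

          toTail : ∀ {r} → Sorted r → (∀ {x} → x ∈ r → x ∈ˢ N × x ≤ m) →
                   ∀ {u} → InitialSegment (r ∪ˢ (N above m)) u → (u∈B : B u) → q u u∈B ≡ q w w∈B
          toTail {[]} _ _ isu u∈B =
            q-irrelevant (initialSegmentInB-unique (initialSegment-≐ []∪ˢ⁻ ∪ˢ⁺ʳ isu) isw u∈B w∈B)
                         u∈B w∈B
          toTail {a ∷ r} _ _ {[]} _ []∈B = ⊥-elim ([]∉B []∈B)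
          toTail {a ∷ r} sorted r⊆ {x ∷ u} isu x∷u∈B =
            viaSuccessor (initialSegment-head isu a∈Y a≤Y) isu x∷u∈B
            where
            Y : Subset
            Y = (a ∷ r) ∪ˢ (N above m)
            a<W : ∀ {y} → y ∈ˢ N above m → a < y
            a<W y∈ = ≤-<-trans (proj₂ (r⊆ (here refl))) (proj₂ (above⁻ y∈))
            a∈Y : a ∈ˢ Y
            a∈Y = ⟦⟧⁺ (inj₁ (here refl))
            a≤Y : ∀ {y} → y ∈ˢ Y → a ≤ y
            a≤Y y∈ with ⟦⟧⁻ y∈
            ... | inj₁ (here refl)  = ≤-refl
            ... | inj₁ (there y∈r) = <⇒≤ (head<tail sorted y∈r)
            ... | inj₂ y∈W          = <⇒≤ (a<W y∈W)
            Y⊆N : Y ⊆ˢ N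
            Y⊆N = ∪ˢ-⊆ (λ y∈ → proj₁ (r⊆ y∈)) above-⊆
            viaSuccessor : x ≡ a → InitialSegment Y (x ∷ u) → (b : B (x ∷ u)) → q (x ∷ u) b ≡ q w w∈B
            viaSuccessor refl isu x∷u∈B =
              let v , isv , v∈B , x∷u◁v = ◁-successor Y (∪ˢ-infinite (above-infinite inf))
                                                      (⊆ˢ-trans Y⊆N N⊆⋃B) isu x∷u∈B
              in trans (◁-sameQ x∷u◁v (x∷u∈B , λ y∈ → Y⊆N (InitialSegment.⊆Y isu y∈))
                                      (v∈B , λ y∈ → Y⊆N (above-⊆ (InitialSegment.⊆Y isv y∈))))
                       (toTail (Linked.tail sorted) (λ y∈ → r⊆ (there y∈))
                               (initialSegment-≐ ∪ˢ-above⁻ (∪ˢ-above⁺ sorted a<W) isv) v∈B)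

          member-toTail : ∀ {s} (s∈ : Restrict N s) → sum s ≤ m → q s (proj₁ s∈) ≡ q w w∈B
          member-toTail {s} (s∈B , s⊆N) Σs≤m =
            toTail (members-sorted s s∈B) (λ x∈ → s⊆N x∈ , x≤m x∈) (∪ˢ-above-initial (members-sorted s s∈B) x≤m) s∈B
            where
            x≤m : ∀ {x} → x ∈ s → x ≤ m
            x≤m x∈ = ≤-trans (∈⇒≤sum x∈) Σs≤m

        q-constant : ∀ {s t} (s∈ : Restrict N s) (t∈ : Restrict N t) → q s (proj₁ s∈) ≡ q t (proj₁ t∈)
        q-constant {s} {t} s∈ t∈ = viaTail (initialSegmentInB (N above m) (above-infinite inf) (⊆ˢ-trans above-⊆ N⊆⋃B))
          where
          m : ℕ
          m = sum s + sum t
          viaTail : (∃ λ w → InitialSegment (N above m) w × B w) → q s (proj₁ s∈) ≡ q t (proj₁ t∈)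
          viaTail (w , isw , w∈B) = trans (member-toTail s∈ (m≤m+n (sum s) (sum t)))
                                          (sym (member-toTail t∈ (m≤n+m (sum t) (sum s))))
            where open TowardsTail m w isw w∈B

        good : Goal
        good with initialSegmentInB N inf N⊆⋃B
        ... | s₀ , is₀ , s₀∈B = goodAt (bqoT q₀ (Restrict N) (restrict-barrier N inf N⊆⋃B) g)
          where
          s₀∈ : Restrict N s₀
          s₀∈ = s₀∈B , InitialSegment.⊆Y is₀
          q₀ : Q
          q₀ = q s₀ s₀∈B
          g : (s : List ℕ) → Restrict N s → Σ (P q₀) (T q₀)
          g s s∈ = fibre (f̂ s (proj₁ s∈)) (q-constant s∈ s₀∈)
          goodAt : Good (Induced (_≤P_ q₀) (T q₀)) (Restrict N) g → Goal
          goodAt (s , t , s∈ , t∈ , s◁t , gₛ≤gₜ) =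
            s , t , canonical s (proj₁ s∈) , canonical t (proj₁ t∈) , s◁t ,
            fibre-≤⇒≤L (f̂ s (proj₁ s∈)) (f̂ t (proj₁ t∈)) (q-constant s∈ s₀∈) (q-constant t∈ s₀∈)
                       gₛ≤gₜ

      good : Goal
      good with nashWilliams ⋃B ⋃B-infinite
      ... | record { set = N ; infinite = inf ; ⊆M = N⊆⋃B ; property = inj₁ meets } =
        WhenMeets.good N inf N⊆⋃B meets
      ... | record { set = N ; infinite = inf ; ⊆M = N⊆⋃B ; property = inj₂ avoids } =
        goodWhenAvoids N inf N⊆⋃B avoids

    restrictedLexSum-bqo : ∀ S T → IsBqo (Σ Q S) (Induced _≤Q_ S) →
                           (∀ q → IsBqo (Σ (P q) (T q)) (Induced (_≤P_ q) (T q))) →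
                           IsBqo (Σ (LexSum Q P) (Restricted S T)) (Induced _≤L_ (Restricted S T))
    restrictedLexSum-bqo S T bqoS bqoT B bar f = RestrictedLexSumBqo.good S T bqoS bqoT bar f

mainTheorem7 : (Q : Set) (_≤Q_ : Q → Q → Set) (P : Q → Set)
               (_≤P_ : (q : Q) → P q → P q → Set) →
               IsPoset Q _≤Q_ → IsSigmaBqo Q _≤Q_ →
               (∀ q → IsPoset (P q) (_≤P_ q)) →
               (∀ q → IsSigmaBqo (P q) (_≤P_ q)) →
               IsSigmaBqo (LexSum Q P) (LexLe _≤Q_ P _≤P_)
mainTheorem7 Q _≤Q_ P _≤P_ posetQ σbqoQ _ σbqoP =
  (antichainFree , descendingFree) , DiagonalPiece σQ.Piece σP.Piece ,
  diagonalPiece-cover σQ.covered σP.covered , pieceBqo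
  where
  module σQ = SigmaBqo _≤Q_ σbqoQ
  module σP (q : Q) = SigmaBqo (_≤P_ q) (σbqoP q)
  -- Each clause below gets hold of an element of Q, hence of excluded middle.
  module Lex (q : Q) = Classical.LexicographicSum (σQ.σbqo⇒em q) _≤Q_ P _≤P_

  antichainFree : ¬ HasInfiniteAntichain (LexSum Q P) (LexLe _≤Q_ P _≤P_)
  antichainFree (g , antichain) =
    Lex.lexSum-antichainFree (proj₁ (g 0)) (proj₁ σQ.wqo) (λ q → proj₁ (σP.wqo q)) (g , antichain)

  descendingFree : ¬ HasInfiniteDescending (LexSum Q P) (LexLe _≤Q_ P _≤P_)
  descendingFree (g , descending) =
    Lex.lexSum-descendingFree (proj₁ (g 0)) posetQ (proj₂ σQ.wqo) (λ q → proj₂ (σP.wqo q)) (g , descending)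

  pieceBqo : ∀ k → IsBqo (Σ (LexSum Q P) (DiagonalPiece σQ.Piece σP.Piece k))
                         (Induced (LexLe _≤Q_ P _≤P_) (DiagonalPiece σQ.Piece σP.Piece k))
  pieceBqo k B bar f =
    let n = proj₁ (unpair k)
        s , s∈B = bqo⇒barrierMember (Induced _≤Q_ (σQ.Piece n)) (σQ.piece-bqo n) bar
                    λ s s∈B → proj₁ (proj₁ (f s s∈B)) , proj₁ (proj₂ (f s s∈B))
    in Lex.restrictedLexSum-bqo (proj₁ (proj₁ (f s s∈B))) _ _ (σQ.piece-bqo n)
                                (λ q → σP.piece-bqo q (proj₂ (unpair k))) B bar f
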